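{- Every digraph $\vec H$ satisfies $\alpha(\Gamma(\vec H/\!\sim))=\mathsf{img}(\vec H)$.
   Context: Digraphs are finite, no multiple arcs, loops allowed. $\vec H/\!\sim$ is the DAG obtained by contracting each strongly connected component of $\vec H$ to a single vertex and deleting loops. For a DAG $\vec D$ with sources (indegree-$0$ vertices) $s_1,\dots,s_k$, its contour $\Gamma(\vec D)$ is the hypergraph on the non-source vertices with hyperedges the nonempty sets $R(s_i)\setminus\{s_i\}$, where $R(s)$ is the set of vertices reachable from $s$. $\alpha$ of a hypergraph is the maximum size of a vertex set no two of whose elements lie in a common hyperedge. An induced matching gadget of size $k$ of a DAG $\vec D$ is a set of arcs $(s_1,w_1),\dots,(s_k,w_k)\in E(\vec D)$ such that no two distinct $w_i,w_j$ are reachable from a single source of $\vec D$; $\mathsf{img}(\vec D)$ is the maximum size of such a gadget, and for a digraph $\vec H$, $\mathsf{img}(\vec H):=\mathsf{img}(\vec H/\!\sim)$. -}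

module Defs where

open import Data.Nat using (ℕ; _≤_)
open import Data.Fin using (Fin)
open import Data.Bool using (Bool; T)
open import Data.Product using (Σ; ∃; _×_)
open import Relation.Nullary using (¬_)
open import Relation.Binary.PropositionalEquality using (_≢_)
open import Relation.Binary.Construct.Closure.ReflexiveTransitive using (Star)

-- A finite digraph on vertex set Fin n (loops allowed, no multiple arcs):
-- H u v = true  iff  (u , v) is an arc.
Digraph : ℕ → Set
Digraph n = Fin n → Fin n → Bool

module _ {n : ℕ} (H : Digraph n) where

  Arc : Fin n → Fin n → Set
  Arc u v = T (H u v)

  Reach : Fin n → Fin n → Set
  Reach = Star Arc

  SC : Fin n → Fin n → Set
  SC u v = Reach u v × Reach v u

  -- Arcs of the contracted DAG H/~ , whose vertices are the SCCs of H,
  -- each SCC represented by any of its vertices (equality of vertices of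
  -- H/~ is SC).
  QArc : Fin n → Fin n → Set
  QArc u v = ¬ SC u v × ∃ λ u' → ∃ λ v' → SC u u' × SC v v' × Arc u' v'

-- Notions for a DAG D whose vertices are the classes of an equivalence _≈_
-- on Fin n (vertices given by representatives) with arc relation A
-- (assumed invariant under _≈_).
module DAGNotions {n : ℕ} (_≈_ : Fin n → Fin n → Set)
                  (A : Fin n → Fin n → Set) where

  DReach : Fin n → Fin n → Set
  DReach = Star A

  IsSource : Fin n → Set
  IsSource s = ∀ u → ¬ A u s

  -- v lies in the hyperedge R(s) ∖ {s} of the contour, s a source
  InHyperedge : Fin n → Fin n → Set
  InHyperedge s v = IsSource s × DReach s v × ¬ (s ≈ v)

  IsIndepSet : (k : ℕ) → (Fin k → Fin n) → Set
  IsIndepSet k f =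
      (∀ i → ¬ IsSource (f i))
    × (∀ i j → i ≢ j → ¬ (f i ≈ f j))
    × (∀ i j → i ≢ j → ∀ s → ¬ (InHyperedge s (f i) × InHyperedge s (f j)))

  HasIndepSet : ℕ → Set
  HasIndepSet k = Σ (Fin k → Fin n) (IsIndepSet k)

  IsGadget : (k : ℕ) → (Fin k → Fin n) → (Fin k → Fin n) → Set
  IsGadget k s w =
      (∀ i → IsSource (s i) × A (s i) (w i))
    × (∀ i j → i ≢ j → ¬ ((s i ≈ s j) × (w i ≈ w j)))
    × (∀ i j → i ≢ j → ∀ t → IsSource t → ¬ (DReach t (w i) × DReach t (w j)))

  HasGadget : ℕ → Set
  HasGadget k = Σ (Fin k → Fin n) λ s → Σ (Fin k → Fin n) λ w → IsGadget k s w

IsMax : (ℕ → Set) → ℕ → Set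
IsMax P m = P m × (∀ k → P k → k ≤ m)

AlphaContourQuot : {n : ℕ} → Digraph n → ℕ → Set
AlphaContourQuot H m = IsMax (DAGNotions.HasIndepSet (SC H) (QArc H)) m

-- img(H) = img(H/~) = m
Img : {n : ℕ} → Digraph n → ℕ → Set
Img H m = IsMax (DAGNotions.HasGadget (SC H) (QArc H)) m

-- Every non-source vertex v of the DAG H/~ lies below a source s; let (s , w) be the first arc
-- of a path from s to v.  For an independent set {v_i} of the contour these arcs form an induced
-- matching gadget, since a source reaching w_i and w_j would put v_i and v_j in a common hyperedge.
-- Conversely the heads w_i of a gadget form an independent set.  So both notions are attained by
-- the same sizes, and a common maximum exists: everything is decidable over the finite vertex set
-- and independent sets have at most n elements.
module Submission where

open import Defs
open import Level using (Level)
open import Data.Nat using (ℕ; zero; suc; _≤_)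
open import Data.Nat.Properties using (≤-pred; ≤∧≢⇒<)
open import Data.Fin using (Fin; _≟_; funToFin; finToFun)
open import Data.Fin.Properties using (any?; all?; injective⇒≤; finToFun-funToFin)
open import Data.Fin.Subset using (Subset; _∈_; _⊆_; _⊂_; ⊤; ⁅_⁆; ∁; _∩_)
open import Data.Fin.Subset.Properties
  using (_∈?_; ∈⊤; x∈p∩q⁺; x∈p∩q⁻; x∉p⇒x∈∁p; x∈∁p⇒x∉p; x≢y⇒x∉⁅y⁆; x∉⁅y⁆⇒x≢y)
open import Data.Fin.Subset.Induction using (Acc; acc; ⊂-wellFounded)
open import Data.Bool.Properties using (T?)
open import Data.Empty using (⊥-elim)
open import Data.Sum using (_⊎_; inj₁; inj₂)
open import Data.Product using (Σ; ∃; ∃₂; _×_; _,_; proj₁; proj₂)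
open import Function using (id; _∘_)
open import Relation.Nullary using (¬_; Dec; yes; no)
open import Relation.Nullary.Decidable using (map′; _×-dec_; _→-dec_; ¬?)
open import Relation.Binary.Core using (Rel)
open import Relation.Binary.Definitions using (Decidable)
open import Relation.Binary.PropositionalEquality using (_≡_; _≢_; refl; sym; subst; subst₂)
open import Relation.Binary.Construct.Closure.ReflexiveTransitive
  using (Star; ε; _◅_; _◅◅_; gmap; kleisliStar)

private
  variable
    ℓ : Level
    n : ℕ
    x y z : Fin n

_-_ : Subset n → Fin n → Subset n
p - x = p ∩ ∁ ⁅ x ⁆

x∈p-y⁺ : ∀ {p : Subset n} {x y} → x ∈ p → x ≢ y → x ∈ p - y
x∈p-y⁺ x∈p x≢y = x∈p∩q⁺ (x∈p , x∉p⇒x∈∁p (x≢y⇒x∉⁅y⁆ x≢y))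

x∈p-y⁻ : ∀ (p : Subset n) {x y} → x ∈ p - y → x ∈ p × x ≢ y
x∈p-y⁻ p x∈p-y with x∈p∩q⁻ p _ x∈p-y
... | x∈p , x∈∁⁅y⁆ = x∈p , x∉⁅y⁆⇒x≢y (x∈∁p⇒x∉p x∈∁⁅y⁆)

p-x⊂p : ∀ {p : Subset n} {x} → x ∈ p → p - x ⊂ p
p-x⊂p {p = p} {x} x∈p = proj₁ ∘ x∈p-y⁻ p , x , x∈p , λ x∈p-x → proj₂ (x∈p-y⁻ p x∈p-x) refl

module _ {R : Rel (Fin n) ℓ} (R? : Decidable R) where

  -- Walks in Star (From S) are the R-walks whose vertices, except possibly the last, lie in S.
  From : Subset n → Rel (Fin n) ℓ
  From S x y = x ∈ S × R x y

  From-mono : ∀ {S T} → S ⊆ T → Star (From S) x y → Star (From T) x y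
  From-mono S⊆T = gmap id λ (x∈S , r) → S⊆T x∈S , r

  last-exit : ∀ {S u x v} → Star (From S) x v →
              Star (From (S - u)) x v ⊎ ∃ λ w → R u w × Star (From (S - u)) w v
  last-exit ε = inj₁ ε
  last-exit {u = u} {x} ((x∈S , r) ◅ p) with last-exit p | x ≟ u
  ... | inj₂ exit   | _        = inj₂ exit
  ... | inj₁ p'     | yes refl = inj₂ (_ , r , p')
  ... | inj₁ p'     | no x≢u   = inj₁ ((x∈p-y⁺ x∈S x≢u , r) ◅ p')

  star-from? : ∀ S → Acc _⊂_ S → Decidable (Star (From S))
  star-from? S (acc rec) u v with u ≟ v | u ∈? S
  ... | yes refl | _      = yes ε
  ... | no u≢v   | no u∉S = no λ { ε → u≢v refl ; ((u∈S , _) ◅ _) → u∉S u∈S }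
  ... | no u≢v   | yes u∈S =
    map′ (λ (w , r , p) → (u∈S , r) ◅ From-mono (proj₁ ∘ x∈p-y⁻ S) p) leave-u
         (any? λ w → R? u w ×-dec star-from? (S - u) (rec (p-x⊂p u∈S)) w v)
    where
    leave-u : Star (From S) u v → ∃ λ w → R u w × Star (From (S - u)) w v
    leave-u p with last-exit {u = u} p
    ... | inj₂ exit                   = exit
    ... | inj₁ ε                      = ⊥-elim (u≢v refl)
    ... | inj₁ ((u∈S-u , _) ◅ _)      = ⊥-elim (proj₂ (x∈p-y⁻ S u∈S-u) refl)

  star? : Decidable (Star R)
  star? u v = map′ (gmap id proj₂) (gmap id (∈⊤ ,_)) (star-from? ⊤ (⊂-wellFounded ⊤) u v)

module _ {A : Rel (Fin n) ℓ} (A? : Decidable A) (acyclic : ∀ {u v} → A u v → ¬ Star A v u) where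

  IsSourceOf : Fin n → Set ℓ
  IsSourceOf s = ∀ u → ¬ A u s

  source-above-in : ∀ S → Acc _⊂_ S → ∀ v → (∀ {y} → Star A y v → y ∈ S) →
                    ∃ λ s → IsSourceOf s × Star A s v
  source-above-in S (acc rec) v anc with any? (λ u → A? u v)
  ... | no no-pred    = v , (λ u a → no-pred (u , a)) , ε
  ... | yes (u , a) =
    let s , src , s↝u = source-above-in (S - v) (rec (p-x⊂p (anc ε))) u
                          λ y↝u → x∈p-y⁺ (anc (y↝u ◅◅ a ◅ ε)) λ { refl → acyclic a y↝u }
    in s , src , s↝u ◅◅ a ◅ ε

  source-above : ∀ v → ∃ λ s → IsSourceOf s × Star A s v
  source-above v = source-above-in ⊤ (⊂-wellFounded ⊤) v (λ _ → ∈⊤)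

∃-fun? : ∀ {k} (P : (Fin k → Fin n) → Set ℓ) → (∀ {f g} → (∀ i → f i ≡ g i) → P f → P g) →
         (∀ f → Dec (P f)) → Dec (∃ P)
∃-fun? {n = n} {k = k} P resp P? =
  map′ (λ (c , p) → finToFun c , p)
       (λ (f , p) → funToFin f , resp (sym ∘ finToFun-funToFin f) p)
       (any? (P? ∘ finToFun {n} {k}))

max-exists : (P : ℕ → Set) → (∀ k → Dec (P k)) → P 0 → ∀ b → (∀ k → P k → k ≤ b) → ∃ (IsMax P)
max-exists P P? p₀ zero    bound = 0 , p₀ , bound
max-exists P P? p₀ (suc b) bound with P? (suc b)
... | yes p = suc b , p , bound
... | no ¬p = max-exists P P? p₀ b λ k pk → ≤-pred (≤∧≢⇒< (bound k pk) λ { refl → ¬p pk })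

module Condensation (H : Digraph n) where
  open DAGNotions (SC H) (QArc H)

  reach? : Decidable (Reach H)
  reach? = star? λ u v → T? (H u v)

  sc? : Decidable (SC H)
  sc? u v = reach? u v ×-dec reach? v u

  SC-refl : SC H x x
  SC-refl = ε , ε

  SC-sym : SC H x y → SC H y x
  SC-sym (x↝y , y↝x) = y↝x , x↝y

  SC-trans : SC H x y → SC H y z → SC H x z
  SC-trans (x↝y , y↝x) (y↝z , z↝y) = x↝y ◅◅ y↝z , z↝y ◅◅ y↝x

  QArc-respʳ : QArc H x y → SC H y z → QArc H x z
  QArc-respʳ (x≁y , x' , y' , x~x' , y~y' , a) y~z =
    (λ x~z → x≁y (SC-trans x~z (SC-sym y~z))) , x' , y' , x~x' , SC-trans (SC-sym y~z) y~y' , a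

  qarc? : Decidable (QArc H)
  qarc? u v = ¬? (sc? u v) ×-dec any? λ u' → any? λ v' → sc? u u' ×-dec sc? v v' ×-dec T? (H u' v')

  QArc⇒Reach : QArc H x y → Reach H x y
  QArc⇒Reach (_ , _ , _ , x~x' , y~y' , a) = proj₁ x~x' ◅◅ a ◅ proj₂ y~y'

  DReach⇒Reach : DReach x y → Reach H x y
  DReach⇒Reach = kleisliStar id QArc⇒Reach

  QArc-acyclic : QArc H x y → ¬ DReach y x
  QArc-acyclic q y↝x = proj₁ q (QArc⇒Reach q , DReach⇒Reach y↝x)

  IsSource-resp : IsSource x → SC H x y → IsSource y
  IsSource-resp src x~y u q = src u (QArc-respʳ q (SC-sym x~y))

  isSource? : ∀ s → Dec (IsSource s)
  isSource? s = all? λ u → ¬? (qarc? u s)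

  inHyperedge? : Decidable InHyperedge
  inHyperedge? s v = isSource? s ×-dec star? qarc? s v ×-dec ¬? (sc? s v)

  source-arc-above : ∀ v → ¬ IsSource v → ∃₂ λ s w → IsSource s × QArc H s w × DReach w v
  source-arc-above v ¬src with source-above qarc? QArc-acyclic v
  ... | s , src , ε         = ⊥-elim (¬src src)
  ... | s , src , q ◅ w↝v   = s , _ , src , q , w↝v

  arc-reaches-class : QArc H x y → SC H y z → DReach x y × DReach x z
  arc-reaches-class q y~z = q ◅ ε , QArc-respʳ q y~z ◅ ε

  HasGadget⇒HasIndepSet : ∀ {k} → HasGadget k → HasIndepSet k
  HasGadget⇒HasIndepSet (s , w , arcs , _ , separated) =
      w
    , (λ i src → src (s i) (proj₂ (arcs i)))
    , (λ i j i≢j wi~wj → separated i j i≢j (s i) (proj₁ (arcs i)) (arc-reaches-class (proj₂ (arcs i)) wi~wj))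
    , λ i j i≢j t ((src , t↝wi , _) , (_ , t↝wj , _)) → separated i j i≢j t src (t↝wi , t↝wj)

  HasIndepSet⇒HasGadget : ∀ {k} → HasIndepSet k → HasGadget k
  HasIndepSet⇒HasGadget {k} (f , non-source , _ , independent) =
      s , w , (λ i → src i , arc i)
    , (λ i j i≢j (_ , wi~wj) → separated i j i≢j (s i) (src i) (arc-reaches-class (arc i) wi~wj))
    , separated
    where
    above : ∀ i → ∃₂ λ s w → IsSource s × QArc H s w × DReach w (f i)
    above i = source-arc-above (f i) (non-source i)

    s w : Fin k → Fin n
    s i = proj₁ (above i)
    w i = proj₁ (proj₂ (above i))

    src : ∀ i → IsSource (s i)
    src i = proj₁ (proj₂ (proj₂ (above i)))

    arc : ∀ i → QArc H (s i) (w i)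
    arc i = proj₁ (proj₂ (proj₂ (proj₂ (above i))))

    w↝f : ∀ i → DReach (w i) (f i)
    w↝f i = proj₂ (proj₂ (proj₂ (proj₂ (above i))))

    separated : ∀ i j → i ≢ j → ∀ t → IsSource t → ¬ (DReach t (w i) × DReach t (w j))
    separated i j i≢j t t-src (t↝wi , t↝wj) = independent i j i≢j t (in-edge i t↝wi , in-edge j t↝wj)
      where
      in-edge : ∀ l → DReach t (w l) → InHyperedge t (f l)
      in-edge l t↝wl = t-src , t↝wl ◅◅ w↝f l , λ t~f → non-source l (IsSource-resp t-src t~f)

  IsIndepSet-resp : ∀ {k} {f g : Fin k → Fin n} → (∀ i → f i ≡ g i) → IsIndepSet k f → IsIndepSet k g
  IsIndepSet-resp f≗g (non-source , distinct , independent) =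
      (λ i → subst (¬_ ∘ IsSource) (f≗g i) (non-source i))
    , (λ i j i≢j → subst₂ (λ x y → ¬ SC H x y) (f≗g i) (f≗g j) (distinct i j i≢j))
    , λ i j i≢j t → subst₂ (λ x y → ¬ (InHyperedge t x × InHyperedge t y)) (f≗g i) (f≗g j) (independent i j i≢j t)

  isIndepSet? : ∀ {k} (f : Fin k → Fin n) → Dec (IsIndepSet k f)
  isIndepSet? f =
          all? (λ i → ¬? (isSource? (f i)))
    ×-dec all? (λ i → all? λ j → ¬? (i ≟ j) →-dec ¬? (sc? (f i) (f j)))
    ×-dec all? (λ i → all? λ j → ¬? (i ≟ j) →-dec all? λ t → ¬? (inHyperedge? t (f i) ×-dec inHyperedge? t (f j)))

  hasIndepSet? : ∀ k → Dec (HasIndepSet k)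
  hasIndepSet? k = ∃-fun? (IsIndepSet k) IsIndepSet-resp isIndepSet?

  HasIndepSet⇒≤ : ∀ k → HasIndepSet k → k ≤ n
  HasIndepSet⇒≤ k (f , _ , distinct , _) = injective⇒≤ f-injective
    where
    f-injective : ∀ {i j} → f i ≡ f j → i ≡ j
    f-injective {i} {j} fi≡fj with i ≟ j
    ... | yes i≡j = i≡j
    ... | no  i≢j = ⊥-elim (distinct i j i≢j (subst (SC H (f i)) fi≡fj SC-refl))

lemma30 : (n : ℕ) (H : Digraph n) →
    Σ ℕ (λ m → AlphaContourQuot H m × Img H m)
lemma30 n H =
  let open Condensation H
      m , indep-m , indep≤m = max-exists _ hasIndepSet? ((λ ()) , (λ ()) , (λ ()) , (λ ())) n HasIndepSet⇒≤
  in m , (indep-m , indep≤m) , (HasIndepSet⇒HasGadget indep-m , λ k → indep≤m k ∘ HasGadget⇒HasIndepSet)
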